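{- Let $p$ be an odd prime and $G\cong \mathbb{Z}_p\oplus\mathbb{Z}_2\oplus\mathbb{Z}_2$. Then there exists an MRS$^*_G(p,4;1)$.
   Context: $\mathbb{Z}_v$ denotes the additive group of integers modulo $v$. For a finite abelian group $(G,+)$ of order $xyz$, an MRS$^*_G(x,y;z)$ is a collection of $z$ arrays of size $x\times y$ whose entries are elements of $G$, each element of $G$ appearing exactly once among all the arrays, such that every row sum and every column sum in every array equals $0$. -}

module Defs where

open import Data.Nat using (ℕ)
open import Data.Nat.Divisibility using (_∣_)
open import Data.Fin using (Fin; toℕ)
open import Data.List using (map; allFin)
open import Data.Nat.ListAction using (sum)
open import Data.Product using (_×_; proj₁; proj₂; uncurry)
open import Function using (_∘_)
open import Function.Definitions using (Bijective)
open import Relation.Binary.PropositionalEquality using (_≡_)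

ZpZ2Z2 : ℕ → Set
ZpZ2Z2 p = Fin p × Fin 2 × Fin 2

sumFin : (n : ℕ) → (Fin n → ℕ) → ℕ
sumFin n f = sum (map f (allFin n))

-- A finite family of elements of Z_p ⊕ Z_2 ⊕ Z_2 sums to 0 in the group
-- iff the sums of the canonical representatives of each coordinate vanish
-- modulo p, 2, 2 respectively.
SumsToZero : (p n : ℕ) → (Fin n → ZpZ2Z2 p) → Set
SumsToZero p n f =
  (p ∣ sumFin n (toℕ ∘ proj₁ ∘ f)) ×
  (2 ∣ sumFin n (toℕ ∘ proj₁ ∘ proj₂ ∘ f)) ×
  (2 ∣ sumFin n (toℕ ∘ proj₂ ∘ proj₂ ∘ f))

-- An MRS*_G(x, y; 1) for G = Z_p ⊕ Z_2 ⊕ Z_2 (with x * y = |G| = 4p):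
-- a single x × y array whose entries are the elements of G, each exactly
-- once, and all row sums and column sums are 0.
MRS*-ZpZ2Z2 : (p x y : ℕ) → (Fin x → Fin y → ZpZ2Z2 p) → Set
MRS*-ZpZ2Z2 p x y A =
  Bijective _≡_ _≡_ (uncurry A) ×
  (∀ i → SumsToZero p y (A i)) ×
  (∀ j → SumsToZero p x (λ i → A i j))

{-# OPTIONS --safe #-}
-- Put in row i the four elements (F_e(i), e), one for each label e ∈ Z₂ ⊕ Z₂, where
-- F₀(x) = x, F₁(x) = 1 − x, F₂(x) = 2x − 1, F₃(x) = −2x. Each F_e is an affine bijection
-- of Z_p, so every group element occurs exactly once, and F₀ + F₁ + F₂ + F₃ = 0, so every
-- row sums to 0. If column e held label e in every row, its Z_p-part would be
-- Σ_{i<p} F_e(i) ≡ 0 (as p is odd), but its Z₂ ⊕ Z₂-part would be p·e = e. Permuting the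
-- labels of rows 0 and 1 by σ₀, σ₁ with σ₀ e + σ₁ e = e repairs the Z₂ ⊕ Z₂-part, and
-- σ₀, σ₁ are chosen with F_{σ₀ e}(0) + F_{σ₁ e}(1) = F_e(0) + F_e(1), so the Z_p-part is unchanged.
module Submission where

open import Defs
open import Data.Nat.Base as ℕ using (ℕ; zero; suc; NonZero; s<s)
import Data.Nat.Properties as ℕ
import Data.Nat.ListAction as ℕ using (sum)
open import Data.Nat.DivMod using (_%_; _/_; m<n⇒m%n≡m; m≡m%n+[m/n]*n; m%n<n)
open import Data.Nat.Divisibility as ℕ using (_∣_; >⇒∤; m%n≡0⇒n∣m)
open import Data.Nat.Primality using (Prime; ¬prime[1])
open import Data.Integer.Base using (ℤ; +_; _+_; _-_; _*_; -_; ∣_∣; _%ℕ_; _/ℕ_; 0ℤ; 1ℤ; -1ℤ)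
open import Data.Integer.Properties
  using ( +-injective; *-cancelˡ-≡; +-identityʳ; i-j≡0⇒i≡j; ∣i∣≡0⇒i≡0; [+m]-[+n]≡m⊖n
        ; ∣m⊝n∣≤m⊔n; pos-+; pos-*; +-*-semiring)
open import Data.Integer.DivMod using (n%ℕd<d; a≡a%ℕn+[a/ℕn]*n)
open import Data.Integer.Divisibility.Signed as ℤ
  using (divides; ∣⇒∣ᵤ; ∣m∣n⇒∣m+n; ∣m∣n⇒∣m-n; ∣n⇒∣m*n; ∣m⇒∣m*n)
open import Data.Integer.Tactic.RingSolver using (solve-∀)
open import Algebra.Properties.Semiring.Sum +-*-semiring using (sum; sum-syntax; sum-cong-≗; sum-permute)
open import Data.Fin.Base using (Fin; zero; suc; toℕ; fromℕ<)
open import Data.Fin.Patterns using (0F; 1F; 2F; 3F)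
open import Data.Fin.Properties using (toℕ-fromℕ<; toℕ-injective; toℕ<n; *↔×)
open import Data.List.Properties using (map-tabulate)
open import Data.Product.Base using (Σ; _×_; _,_; proj₁; proj₂; uncurry)
open import Data.Product.Algebra using (×-comm)
open import Data.Product.Function.Dependent.Propositional using (Σ-↔)
open import Function.Base using (_∘_; id)
open import Function.Bundles using (_↔_; Inverse; Bijection; mk↔ₛ′)
open import Function.Construct.Composition using (_↔-∘_)
open import Function.Properties.Inverse using (↔-refl; ↔⇒⤖)
open import Function.Definitions using (Bijective)
open import Relation.Nullary using (¬_; contradiction)
open import Relation.Binary.PropositionalEquality

open Inverse using (to)

ι : ∀ {n} → Fin n → ℤ
ι i = + toℕ i

infix 4 _≡_mod_
_≡_mod_ : ℤ → ℤ → ℕ → Set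
x ≡ y mod q = + q ℤ.∣ x - y

infixl 7 _modℤ_
_modℤ_ : ℤ → (q : ℕ) .{{_ : NonZero q}} → Fin q
x modℤ q = fromℕ< (n%ℕd<d x q)

ι-modℤ : ∀ x q .{{_ : NonZero q}} → ι (x modℤ q) ≡ x mod q
ι-modℤ x q = divides (- (x /ℕ q)) (begin
  ι (x modℤ q) - x                             ≡⟨ cong (λ r → + r - x) (toℕ-fromℕ< (n%ℕd<d x q)) ⟩
  + (x %ℕ q) - x                               ≡⟨ cong (λ y → + (x %ℕ q) - y) (a≡a%ℕn+[a/ℕn]*n x q) ⟩
  + (x %ℕ q) - (+ (x %ℕ q) + x /ℕ q * + q)     ≡⟨ cancel (+ (x %ℕ q)) (x /ℕ q) (+ q) ⟩
  - (x /ℕ q) * + q                             ∎)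
  where
  open ≡-Reasoning
  cancel : ∀ r k q → r - (r + k * q) ≡ - k * q
  cancel = solve-∀

m∣n∧n<m⇒n≡0 : ∀ {q n} → q ∣ n → n ℕ.< q → n ≡ 0
m∣n∧n<m⇒n≡0 {n = zero}  _   _   = refl
m∣n∧n<m⇒n≡0 {n = suc _} q∣n n<q = contradiction q∣n (>⇒∤ n<q)

remainder-unique : ∀ {q r s} → r ℕ.< q → s ℕ.< q → + r ≡ + s mod q → r ≡ s
remainder-unique {q} {r} {s} r<q s<q q∣r-s =
  +-injective (i-j≡0⇒i≡j (+ r) (+ s) (∣i∣≡0⇒i≡0 (m∣n∧n<m⇒n≡0 (∣⇒∣ᵤ q∣r-s) ∣r-s∣<q)))
  where
  ∣r-s∣<q : ∣ + r - + s ∣ ℕ.< q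
  ∣r-s∣<q = subst (ℕ._< q) (cong ∣_∣ (sym ([+m]-[+n]≡m⊖n r s)))
                  (ℕ.≤-<-trans (∣m⊝n∣≤m⊔n r s) (ℕ.⊔-lub r<q s<q))

modℤ-cong : ∀ x y q .{{_ : NonZero q}} → x ≡ y mod q → x modℤ q ≡ y modℤ q
modℤ-cong x y q x≡y =
  toℕ-injective (remainder-unique (toℕ<n (x modℤ q)) (toℕ<n (y modℤ q)) ι[x]≡ι[y])
  where
  regroup : ∀ a b x y → (a - x) + (x - y) - (b - y) ≡ a - b
  regroup = solve-∀
  ι[x]≡ι[y] : ι (x modℤ q) ≡ ι (y modℤ q) mod q
  ι[x]≡ι[y] = subst (+ q ℤ.∣_) (regroup (ι (x modℤ q)) (ι (y modℤ q)) x y)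
                    (∣m∣n⇒∣m-n (∣m∣n⇒∣m+n (ι-modℤ x q) x≡y) (ι-modℤ y q))

modℤ-ι : ∀ {q} .{{_ : NonZero q}} (i : Fin q) → ι i modℤ q ≡ i
modℤ-ι i = toℕ-injective (trans (toℕ-fromℕ< _) (m<n⇒m%n≡m (toℕ<n i)))

affine-↔ : ∀ q .{{_ : NonZero q}} (c d c⁻¹ : ℤ) → c⁻¹ * c ≡ 1ℤ mod q → Fin q ↔ Fin q
affine-↔ q c d c⁻¹ unit = mk↔ₛ′ f g f∘g g∘f
  where
  f g : Fin q → Fin q
  f i = (c * ι i + d) modℤ q
  g a = (c⁻¹ * (ι a - d)) modℤ q
  f∘g : ∀ a → f (g a) ≡ a
  f∘g a = trans (modℤ-cong (c * ι (g a) + d) (ι a) q congruent) (modℤ-ι a)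
    where
    regroup : ∀ c c⁻¹ d a r → c * r + d - a ≡ c * (r - c⁻¹ * (a - d)) + (c⁻¹ * c - 1ℤ) * (a - d)
    regroup = solve-∀
    congruent : c * ι (g a) + d ≡ ι a mod q
    congruent = subst (+ q ℤ.∣_) (sym (regroup c c⁻¹ d (ι a) (ι (g a))))
      (∣m∣n⇒∣m+n (∣n⇒∣m*n c (ι-modℤ (c⁻¹ * (ι a - d)) q)) (∣m⇒∣m*n (ι a - d) unit))
  g∘f : ∀ i → g (f i) ≡ i
  g∘f i = trans (modℤ-cong (c⁻¹ * (ι (f i) - d)) (ι i) q congruent) (modℤ-ι i)
    where
    regroup : ∀ c c⁻¹ d x r → c⁻¹ * (r - d) - x ≡ c⁻¹ * (r - (c * x + d)) + (c⁻¹ * c - 1ℤ) * x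
    regroup = solve-∀
    congruent : c⁻¹ * (ι (f i) - d) ≡ ι i mod q
    congruent = subst (+ q ℤ.∣_) (sym (regroup c c⁻¹ d (ι i) (ι (f i))))
      (∣m∣n⇒∣m+n (∣n⇒∣m*n c⁻¹ (ι-modℤ (c * ι i + d) q)) (∣m⇒∣m*n (ι i) unit))

sumFin-suc : ∀ n (f : Fin (suc n) → ℕ) → sumFin (suc n) f ≡ f zero ℕ.+ sumFin n (f ∘ suc)
sumFin-suc n f = cong (λ xs → f zero ℕ.+ ℕ.sum xs)
  (trans (map-tabulate suc f) (sym (map-tabulate id (f ∘ suc))))

sumFin-toℤ : ∀ n (f : Fin n → ℕ) → + sumFin n f ≡ ∑[ k < n ] (+ f k)
sumFin-toℤ zero    f = refl
sumFin-toℤ (suc n) f = begin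
  + sumFin (suc n) f                    ≡⟨ cong +_ (sumFin-suc n f) ⟩
  + (f zero ℕ.+ sumFin n (f ∘ suc))     ≡⟨ pos-+ (f zero) _ ⟩
  + f zero + + sumFin n (f ∘ suc)       ≡⟨ cong (_+_ (+ f zero)) (sumFin-toℤ n (f ∘ suc)) ⟩
  + f zero + ∑[ k < n ] (+ f (suc k))     ∎
  where open ≡-Reasoning

∣-sumFin : ∀ q n (f : Fin n → ℕ) → + q ℤ.∣ ∑[ k < n ] (+ f k) → q ∣ sumFin n f
∣-sumFin q n f q∣∑ = ∣⇒∣ᵤ (subst (+ q ℤ.∣_) (sym (sumFin-toℤ n f)) q∣∑)

∑-cong-mod : ∀ q n (f g : Fin n → ℤ) → (∀ k → f k ≡ g k mod q) → sum f ≡ sum g mod q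
∑-cong-mod q zero    f g _   = divides 0ℤ refl
∑-cong-mod q (suc n) f g f≡g = subst (+ q ℤ.∣_) (regroup (f zero) (g zero) _ _)
  (∣m∣n⇒∣m+n (f≡g zero) (∑-cong-mod q n (f ∘ suc) (g ∘ suc) (f≡g ∘ suc)))
  where
  regroup : ∀ a b s t → (a - b) + (s - t) ≡ (a + s) - (b + t)
  regroup = solve-∀

∣-sumFin-modℤ : ∀ q .{{_ : NonZero q}} n (f : Fin n → ℤ) →
                + q ℤ.∣ sum f → q ∣ sumFin n (λ k → toℕ (f k modℤ q))
∣-sumFin-modℤ q n f q∣∑ = ∣-sumFin q n _ (subst (+ q ℤ.∣_) (regroup _ (sum f))
  (∣m∣n⇒∣m+n (∑-cong-mod q n (λ k → ι (f k modℤ q)) f (λ k → ι-modℤ (f k) q)) q∣∑))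
  where
  regroup : ∀ a b → (a - b) + b ≡ a
  regroup = solve-∀

sumsToZero-modℤ : ∀ {p n} .{{_ : NonZero p}} (f : Fin n → ℤ) (b c : Fin n → Fin 2) →
             + p ℤ.∣ sum f → + 2 ℤ.∣ sum (ι ∘ b) → + 2 ℤ.∣ sum (ι ∘ c) →
             SumsToZero p n (λ k → f k modℤ p , b k , c k)
sumsToZero-modℤ {p} {n} f b c p∣f 2∣b 2∣c =
  ∣-sumFin-modℤ p n f p∣f , ∣-sumFin 2 n (toℕ ∘ b) 2∣b , ∣-sumFin 2 n (toℕ ∘ c) 2∣c

∑-const : ∀ n x → ∑[ i < n ] x ≡ + n * x
∑-const zero    x = refl
∑-const (suc n) x = trans (cong (_+_ x) (∑-const n x)) (step x (+ n))
  where
  step : ∀ x n → x + n * x ≡ (1ℤ + n) * x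
  step = solve-∀

∑-affine : ∀ n c d → + 2 * ∑[ i < n ] (c * ι i + d) ≡ + n * (c * (+ n - 1ℤ) + + 2 * d)
∑-affine zero    c d = refl
∑-affine (suc n) c d = begin
  + 2 * ((c * 0ℤ + d) + ∑[ i < n ] (c * (1ℤ + ι i) + d))
    ≡⟨ cong (λ s → + 2 * ((c * 0ℤ + d) + s)) (sum-cong-≗ {n} (λ i → shift c (ι i) d)) ⟩
  + 2 * ((c * 0ℤ + d) + ∑[ i < n ] (c * ι i + (c + d)))
    ≡⟨ distrib c d _ ⟩
  + 2 * d + + 2 * ∑[ i < n ] (c * ι i + (c + d))
    ≡⟨ cong (_+_ (+ 2 * d)) (∑-affine n c (c + d)) ⟩
  + 2 * d + + n * (c * (+ n - 1ℤ) + + 2 * (c + d))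
    ≡⟨ collect c d (+ n) ⟩
  (1ℤ + + n) * (c * ((1ℤ + + n) - 1ℤ) + + 2 * d) ∎
  where
  open ≡-Reasoning
  shift : ∀ c x d → c * (1ℤ + x) + d ≡ c * x + (c + d)
  shift = solve-∀
  distrib : ∀ c d s → + 2 * ((c * 0ℤ + d) + s) ≡ + 2 * d + + 2 * s
  distrib = solve-∀
  collect : ∀ c d n → + 2 * d + n * (c * (n - 1ℤ) + + 2 * (c + d))
                    ≡ (1ℤ + n) * (c * ((1ℤ + n) - 1ℤ) + + 2 * d)
  collect = solve-∀

+[1+2h]≡1+2h : ∀ h → + suc (2 ℕ.* h) ≡ 1ℤ + + 2 * + h
+[1+2h]≡1+2h h = cong (_+_ 1ℤ) (pos-* 2 h)

odd-∣-∑-affine : ∀ h c d → + suc (2 ℕ.* h) ℤ.∣ ∑[ i < suc (2 ℕ.* h) ] (c * ι i + d)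
odd-∣-∑-affine h c d = divides (c * + h + d) (*-cancelˡ-≡ (+ 2) _ _ (begin
  + 2 * ∑[ i < p ] (c * ι i + d)             ≡⟨ ∑-affine p c d ⟩
  + p * (c * (+ p - 1ℤ) + + 2 * d)           ≡⟨ cong (λ P → P * (c * (P - 1ℤ) + + 2 * d)) (+[1+2h]≡1+2h h) ⟩
  P * (c * (P - 1ℤ) + + 2 * d)               ≡⟨ halve c d (+ h) ⟩
  + 2 * ((c * + h + d) * P)                  ≡⟨ cong (λ P → + 2 * ((c * + h + d) * P)) (sym (+[1+2h]≡1+2h h)) ⟩
  + 2 * ((c * + h + d) * + p)                ∎))
  where
  open ≡-Reasoning
  p : ℕ
  p = suc (2 ℕ.* h)
  P : ℤ
  P = 1ℤ + + 2 * + h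
  halve : ∀ c d h → (1ℤ + + 2 * h) * (c * ((1ℤ + + 2 * h) - 1ℤ) + + 2 * d)
                  ≡ + 2 * ((c * h + d) * (1ℤ + + 2 * h))
  halve = solve-∀

permuteFirstTwo : ∀ {n} {E : Set} → E ↔ E → E ↔ E → Fin n → E ↔ E
permuteFirstTwo σ₀ σ₁ zero          = σ₀
permuteFirstTwo σ₀ σ₁ (suc zero)    = σ₁
permuteFirstTwo σ₀ σ₁ (suc (suc _)) = ↔-refl

∑-permuteFirstTwo : ∀ {n} {E : Set} (σ₀ σ₁ : E ↔ E) (g : Fin (2 ℕ.+ n) → E → ℤ) e →
  ∑[ i < 2 ℕ.+ n ] g i (to (permuteFirstTwo σ₀ σ₁ i) e) ≡
  ∑[ i < 2 ℕ.+ n ] g i e + ((g zero (to σ₀ e) + g (suc zero) (to σ₁ e)) - (g zero e + g (suc zero) e))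
∑-permuteFirstTwo {n} σ₀ σ₁ g e =
  regroup (g zero (to σ₀ e)) (g (suc zero) (to σ₁ e)) (g zero e) (g (suc zero) e)
          (∑[ i < n ] g (suc (suc i)) e)
  where
  regroup : ∀ a₀ a₁ b₀ b₁ r → a₀ + (a₁ + r) ≡ b₀ + (b₁ + r) + ((a₀ + a₁) - (b₀ + b₁))
  regroup = solve-∀

-- Its forward map is, definitionally, (i , j) ↦ (to (π e) i , to label e) with e = to (τ i) j.
relabelling-↔ : {R E L : Set} → (R → E ↔ E) → (E → R ↔ R) → E ↔ L → (R × E) ↔ (R × L)
relabelling-↔ τ π label =
  (×-comm _ _ ↔-∘ (Σ-↔ label (λ {e} → π e) ↔-∘ ×-comm _ _)) ↔-∘ Σ-↔ ↔-refl (λ {i} → τ i)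

odd-prime-shape : ∀ {p} → Prime p → ¬ 2 ∣ p → Σ ℕ λ m → p ≡ suc (2 ℕ.* suc m)
odd-prime-shape {p} p-prime p-odd
  with p % 2 | p / 2 | m≡m%n+[m/n]*n p 2 | m%n<n p 2 | m%n≡0⇒n∣m p 2
... | 0           | _     | _   | _            | 2∣p = contradiction (2∣p refl) p-odd
... | 1           | 0     | p≡1 | _            | _   = contradiction (subst Prime p≡1 p-prime) ¬prime[1]
... | 1           | suc m | p≡  | _            | _   = m , trans p≡ (cong suc (ℕ.*-comm (suc m) 2))
... | suc (suc _) | _     | _   | s<s (s<s ()) | _

module Construction (m : ℕ) where

  h p : ℕ
  h = suc m
  p = suc (2 ℕ.* h)

  slope intercept slope⁻¹ : Fin 4 → ℤ
  slope 0F = 1ℤ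
  slope 1F = -1ℤ
  slope 2F = + 2
  slope 3F = - + 2
  intercept 0F = 0ℤ
  intercept 1F = 1ℤ
  intercept 2F = -1ℤ
  intercept 3F = 0ℤ
  -- inverses modulo p = 1 + 2h, since 2 (h + 1) = p + 1 and (−2) h = 1 − p
  slope⁻¹ 0F = 1ℤ
  slope⁻¹ 1F = -1ℤ
  slope⁻¹ 2F = + h + 1ℤ
  slope⁻¹ 3F = + h

  slope-unit : ∀ e → slope⁻¹ e * slope e ≡ 1ℤ mod p
  slope-unit 0F = divides 0ℤ refl
  slope-unit 1F = divides 0ℤ refl
  slope-unit 2F = divides 1ℤ (trans (inverse-of-2 (+ h)) (cong (1ℤ *_) (sym (+[1+2h]≡1+2h h))))
    where
    inverse-of-2 : ∀ h → (h + 1ℤ) * + 2 - 1ℤ ≡ 1ℤ * (1ℤ + + 2 * h)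
    inverse-of-2 = solve-∀
  slope-unit 3F = divides -1ℤ (trans (inverse-of-minus-2 (+ h)) (cong (-1ℤ *_) (sym (+[1+2h]≡1+2h h))))
    where
    inverse-of-minus-2 : ∀ h → h * - + 2 - 1ℤ ≡ -1ℤ * (1ℤ + + 2 * h)
    inverse-of-minus-2 = solve-∀

  F : Fin 4 → ℤ → ℤ
  F e x = slope e * x + intercept e

  π : Fin 4 → Fin p ↔ Fin p
  π e = affine-↔ p (slope e) (intercept e) (slope⁻¹ e) (slope-unit e)

  -- 0, 1, 2, 3 ↦ (0 , 0), (0 , 1), (1 , 0), (1 , 1)
  label : Fin 4 ↔ (Fin 2 × Fin 2)
  label = *↔×

  σ₀ σ₁ : Fin 4 ↔ Fin 4
  σ₀ = mk↔ₛ′ (λ { 0F → 1F ; 1F → 3F ; 2F → 2F ; 3F → 0F })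
             (λ { 0F → 3F ; 1F → 0F ; 2F → 2F ; 3F → 1F })
             (λ { 0F → refl ; 1F → refl ; 2F → refl ; 3F → refl })
             (λ { 0F → refl ; 1F → refl ; 2F → refl ; 3F → refl })
  σ₁ = mk↔ₛ′ (λ { 0F → 1F ; 1F → 2F ; 2F → 0F ; 3F → 3F })
             (λ { 0F → 2F ; 1F → 0F ; 2F → 1F ; 3F → 3F })
             (λ { 0F → refl ; 1F → refl ; 2F → refl ; 3F → refl })
             (λ { 0F → refl ; 1F → refl ; 2F → refl ; 3F → refl })

  τ : Fin p → Fin 4 ↔ Fin 4
  τ = permuteFirstTwo σ₀ σ₁

  A : Fin p → Fin 4 → ZpZ2Z2 p
  A i j = to (π (to (τ i) j)) i , to label (to (τ i) j)

  A-bijective : Bijective _≡_ _≡_ (uncurry A)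
  A-bijective = Bijection.bijective (↔⇒⤖ (relabelling-↔ τ π label))

  β₁ β₂ : Fin 4 → ℤ
  β₁ e = ι (proj₁ (to label e))
  β₂ e = ι (proj₂ (to label e))

  labels-cancel : ∀ x → ∑[ e < 4 ] F e x ≡ 0ℤ
  labels-cancel = identity
    where
    identity : ∀ x → (1ℤ * x + 0ℤ) + ((-1ℤ * x + 1ℤ) + ((+ 2 * x + -1ℤ) + ((- + 2 * x + 0ℤ) + 0ℤ)))
                   ≡ 0ℤ
    identity = solve-∀

  row-sums : ∀ i → SumsToZero p 4 (A i)
  row-sums i = sumsToZero-modℤ (λ j → F (to (τ i) j) (ι i))
    (λ j → proj₁ (to label (to (τ i) j))) (λ j → proj₂ (to label (to (τ i) j)))
    (subst (+ p ℤ.∣_) (sum-permute (λ e → F e (ι i)) (τ i)) (divides 0ℤ (labels-cancel (ι i))))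
    (subst (+ 2 ℤ.∣_) (sum-permute β₁ (τ i)) (divides 1ℤ refl))
    (subst (+ 2 ℤ.∣_) (sum-permute β₂ (τ i)) (divides 1ℤ refl))

  first-rows-balanced : ∀ e → (F (to σ₀ e) 0ℤ + F (to σ₁ e) 1ℤ) - (F e 0ℤ + F e 1ℤ) ≡ 0ℤ
  first-rows-balanced 0F = refl
  first-rows-balanced 1F = refl
  first-rows-balanced 2F = refl
  first-rows-balanced 3F = refl

  labels-balanced₁ : ∀ e → + 2 ℤ.∣ β₁ e + (β₁ (to σ₀ e) + β₁ (to σ₁ e))
  labels-balanced₁ 0F = divides 0ℤ refl
  labels-balanced₁ 1F = divides 1ℤ refl
  labels-balanced₁ 2F = divides 1ℤ refl
  labels-balanced₁ 3F = divides 1ℤ refl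
  labels-balanced₂ : ∀ e → + 2 ℤ.∣ β₂ e + (β₂ (to σ₀ e) + β₂ (to σ₁ e))
  labels-balanced₂ 0F = divides 1ℤ refl
  labels-balanced₂ 1F = divides 1ℤ refl
  labels-balanced₂ 2F = divides 0ℤ refl
  labels-balanced₂ 3F = divides 1ℤ refl

  column-sum-F : ∀ j → + p ℤ.∣ ∑[ i < p ] F (to (τ i) j) (ι i)
  column-sum-F j = subst (+ p ℤ.∣_) (sym (begin
    ∑[ i < p ] F (to (τ i) j) (ι i)            ≡⟨ ∑-permuteFirstTwo σ₀ σ₁ (λ (i : Fin p) e → F e (ι i)) j ⟩
    ∑[ i < p ] F j (ι i) + ((F (to σ₀ j) 0ℤ + F (to σ₁ j) 1ℤ) - (F j 0ℤ + F j 1ℤ))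
                                               ≡⟨ cong (_+_ (∑[ i < p ] F j (ι i))) (first-rows-balanced j) ⟩
    ∑[ i < p ] F j (ι i) + 0ℤ                  ≡⟨ +-identityʳ _ ⟩
    ∑[ i < p ] F j (ι i)                       ∎))
    (odd-∣-∑-affine h (slope j) (intercept j))
    where open ≡-Reasoning

  column-sum-bits : (β : Fin 4 → ℤ) → (∀ e → + 2 ℤ.∣ β e + (β (to σ₀ e) + β (to σ₁ e))) →
                    ∀ j → + 2 ℤ.∣ ∑[ i < p ] β (to (τ i) j)
  column-sum-bits β balanced j = subst (+ 2 ℤ.∣_) (sym (begin
    ∑[ i < p ] β (to (τ i) j)                  ≡⟨ ∑-permuteFirstTwo σ₀ σ₁ (λ (_ : Fin p) → β) j ⟩
    ∑[ i < p ] β j + (s - (b + b))             ≡⟨ cong (_+ (s - (b + b))) (∑-const p b) ⟩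
    + p * b + (s - (b + b))                    ≡⟨ cong (λ P → P * b + (s - (b + b))) (+[1+2h]≡1+2h h) ⟩
    (1ℤ + + 2 * + h) * b + (s - (b + b))       ≡⟨ regroup (+ h) b s ⟩
    (b + s) + (+ h * b - b) * + 2              ∎))
    (∣m∣n⇒∣m+n (balanced j) (divides (+ h * b - b) refl))
    where
    open ≡-Reasoning
    b s : ℤ
    b = β j
    s = β (to σ₀ j) + β (to σ₁ j)
    regroup : ∀ h b s → (1ℤ + + 2 * h) * b + (s - (b + b)) ≡ (b + s) + (h * b - b) * + 2
    regroup = solve-∀

  column-sums : ∀ j → SumsToZero p p (λ i → A i j)
  column-sums j = sumsToZero-modℤ (λ i → F (to (τ i) j) (ι i))
    (λ i → proj₁ (to label (to (τ i) j))) (λ i → proj₂ (to label (to (τ i) j)))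
    (column-sum-F j) (column-sum-bits β₁ labels-balanced₁ j) (column-sum-bits β₂ labels-balanced₂ j)

  A-MRS* : MRS*-ZpZ2Z2 p p 4 A
  A-MRS* = A-bijective , row-sums , column-sums

lemma3p1 : (p : ℕ) → Prime p → ¬ (2 ∣ p) →
    Σ (Fin p → Fin 4 → ZpZ2Z2 p) (λ A → MRS*-ZpZ2Z2 p p 4 A)
lemma3p1 p p-prime p-odd with odd-prime-shape p-prime p-odd
... | m , refl = A , A-MRS*
  where open Construction m
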